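{- The length of every triangular Tangle is even.
   Context: Fix $r>0$ and let $\mathscr T$ be the tiling of the plane by equilateral triangles of side length $2r$. Center a circle of radius $r$ at each vertex of $\mathscr T$; circles at adjacent vertices are tangent at the midpoint of the common edge. A link is a sixth of one of these circles whose endpoints are two consecutive tangency points with circles at adjacent vertices. A triangular Tangle is a smooth (continuously turning tangent) simple closed curve that is the union of finitely many links. Its length is the number of links it consists of. -}

module Defs where

open import Data.Nat using (ℕ; zero; suc)
open import Data.Nat.DivMod using (_mod_)
open import Data.Integer using (ℤ; +_; -[1+_]) renaming (_+_ to _+ℤ_)
open import Data.Fin using (Fin; zero; suc; toℕ)
open import Data.Product using (_×_; _,_; proj₁; proj₂; ∃₂)
open import Data.Sum using (_⊎_)
open import Relation.Binary.PropositionalEquality using (_≡_; _≢_)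

-- Vertices of the triangular tiling 𝒯 (side 2r), in the lattice basis
-- e₁ = 2r·(1,0), e₂ = 2r·(1/2, √3/2): the vertex (a , b) is a·e₁ + b·e₂.
Vertex : Set
Vertex = ℤ × ℤ

-- The six unit lattice directions, in counter-clockwise order
-- (angles 0°, 60°, 120°, 180°, 240°, 300°).
dir : Fin 6 → Vertex
dir zero = (+ 1 , + 0)
dir (suc zero) = (+ 0 , + 1)
dir (suc (suc zero)) = (-[1+ 0 ] , + 1)
dir (suc (suc (suc zero))) = (-[1+ 0 ] , + 0)
dir (suc (suc (suc (suc zero)))) = (+ 0 , -[1+ 0 ])
dir (suc (suc (suc (suc (suc zero))))) = (+ 1 , -[1+ 0 ])

_⊕_ : Vertex → Vertex → Vertex
(a , b) ⊕ (c , d) = (a +ℤ c , b +ℤ d)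

next6 : Fin 6 → Fin 6
next6 j = suc (toℕ j) mod 6

-- Tangency points = midpoints of edges of 𝒯.  Each edge is written
-- uniquely as {v , v ⊕ dir i} with i ∈ {0,1,2}; (v , i) denotes its midpoint.
Point : Set
Point = Vertex × Fin 3

-- The tangency point of the circle at v with the circle at v ⊕ dir j.
mid : Vertex → Fin 6 → Point
mid v zero = (v , zero)
mid v (suc zero) = (v , suc zero)
mid v (suc (suc zero)) = (v , suc (suc zero))
mid v (suc (suc (suc zero))) = (v ⊕ dir (suc (suc (suc zero))) , zero)
mid v (suc (suc (suc (suc zero)))) = (v ⊕ dir (suc (suc (suc (suc zero)))) , suc zero)
mid v (suc (suc (suc (suc (suc zero))))) = (v ⊕ dir (suc (suc (suc (suc (suc zero))))) , suc (suc zero))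

-- A link: (v , j) is the sixth of the circle centred at v running
-- counter-clockwise from  mid v j  (its "start") to  mid v (next6 j)  (its "end").
Link : Set
Link = Vertex × Fin 6

center : Link → Vertex
center = proj₁

data Role : Set where
  start end : Role

EndAt : Link → Point → Role → Set
EndAt (v , j) p start = p ≡ mid v j
EndAt (v , j) p end   = p ≡ mid v (next6 j)

Joins : Link → Point → Point → Set
Joins L a b = (EndAt L a start × EndAt L b end) ⊎ (EndAt L a end × EndAt L b start)

-- Two links meeting at the tangency point p form a smooth (C¹) junction
-- iff they leave p on opposite sides of the common tangent line at p.
-- On the same circle this means they are the two different arcs at p;
-- on the two (tangent) circles at the ends of the edge through p this
-- means they are both the start or both the end of their arcs
-- (counter-clockwise orientation is reversed across the tangency point).
SmoothAt : Point → Link → Link → Set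
SmoothAt p L L' = ∃₂ λ ρ ρ' → EndAt L p ρ × EndAt L' p ρ' ×
  ((center L ≡ center L' × L ≢ L') ⊎ (center L ≢ center L' × ρ ≡ ρ'))

csuc : ∀ {m} → Fin (suc m) → Fin (suc m)
csuc {m} i = suc (toℕ i) mod (suc m)

Injective : {A : Set} {k : ℕ} → (Fin k → A) → Set
Injective {k = k} f = ∀ (i j : Fin k) → f i ≡ f j → i ≡ j

-- A triangular Tangle: a simple closed curve traversed as the cyclic
-- sequence of links  links 0, links 1, …, links m  (then back to links 0),
-- where links k runs from the tangency point pts k to pts (k+1 mod m+1),
-- consecutive links join smoothly, and no tangency point (hence no point
-- at all) is visited twice.
record Tangle : Set where
  field
    m      : ℕ
    links  : Fin (suc m) → Link
    pts    : Fin (suc m) → Point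
    joins  : ∀ k → Joins (links k) (pts k) (pts (csuc k))
    smooth : ∀ k → SmoothAt (pts (csuc k)) (links k) (links (csuc k))
    links-distinct : Injective links
    pts-distinct   : Injective pts

length : Tangle → ℕ
length T = suc (Tangle.m T)

{-# OPTIONS --safe #-}
module Submission where

-- Colour the link (v , j) by the parity of j. Two different arcs of one
-- circle through a tangency point are consecutive, and two arcs on the
-- tangent circles that both start (or both end) at it have opposite
-- directions j and j + 3; either way the colour changes at every smooth
-- junction. A cyclic sequence of links whose colour alternates has even length.

open import Defs
open import Data.Nat.Divisibility using (_∣_; _∣0; n∣n; ∣m∣n⇒∣m+n)
open import Data.Nat using (ℕ; zero; suc; _+_; _*_)
open import Data.Nat.DivMod using (_mod_; _%_; _/_; n%n≡0; m≡m%n+[m/n]*n; [m+kn]%n≡m%n)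
open import Data.Integer using (+_) renaming (_≟_ to _≟ᶻ_)
open import Data.Integer.Properties using (+-0-abelianGroup)
open import Algebra.Properties.AbelianGroup +-0-abelianGroup using (∙-cancelʳ; identityʳ-unique)
open import Data.Fin using (Fin; zero; suc; toℕ)
open import Data.Fin.Properties using (toℕ-injective; toℕ-fromℕ<; all?) renaming (_≟_ to _≟ᶠ_)
open import Data.Product using (_,_; _×_; proj₁; proj₂)
open import Data.Product.Properties using (≡-dec)
open import Data.Sum using (_⊎_; inj₁; inj₂)
open import Data.Bool using (Bool; true; false; not)
open import Data.Bool.Properties using (¬-not; not-involutive) renaming (_≟_ to _≟ᵇ_)
open import Data.Empty using (⊥-elim)
open import Function using (_∘_)
open import Relation.Nullary.Decidable using (from-yes; ¬?; _→-dec_; _⊎-dec_)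
open import Relation.Binary.PropositionalEquality

alternating-return⇒even : (h : ℕ → Bool) → (∀ n → h n ≢ h (suc n)) → ∀ p → h 0 ≡ h p → 2 ∣ p
alternating-return⇒even h alternates zero _ = 2 ∣0
alternating-return⇒even h alternates (suc zero) = ⊥-elim ∘ alternates 0
alternating-return⇒even h alternates (suc (suc p)) h0≡h2+p =
  ∣m∣n⇒∣m+n n∣n (alternating-return⇒even h alternates p (trans h0≡h2+p (sym two-steps)))
  where
  two-steps : h p ≡ h (suc (suc p))
  two-steps = trans (¬-not (alternates p))
    (trans (cong not (¬-not (alternates (suc p)))) (not-involutive _))

csuc-mod : ∀ m n → csuc {m} (n mod suc m) ≡ suc n mod suc m
csuc-mod m n = toℕ-injective (begin
  toℕ (csuc (n mod suc m))                     ≡⟨ toℕ-fromℕ< _ ⟩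
  suc (toℕ (n mod suc m)) % d                  ≡⟨ cong (λ r → suc r % d) (toℕ-fromℕ< _) ⟩
  suc (n % d) % d                              ≡⟨ sym ([m+kn]%n≡m%n (suc (n % d)) (n / d) d) ⟩
  suc (n % d + n / d * d) % d                  ≡⟨ cong (λ r → suc r % d) (sym (m≡m%n+[m/n]*n n d)) ⟩
  suc n % d                                    ≡⟨ sym (toℕ-fromℕ< _) ⟩
  toℕ (suc n mod suc m)                        ∎)
  where
  open ≡-Reasoning
  d : ℕ
  d = suc m

n-mod-n≡zero : ∀ m → suc m mod suc m ≡ zero
n-mod-n≡zero m = toℕ-injective (trans (toℕ-fromℕ< _) (n%n≡0 (suc m)))

alternating-cycle⇒even : ∀ {m} (f : Fin (suc m) → Bool) → (∀ k → f k ≢ f (csuc k)) → 2 ∣ suc m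
alternating-cycle⇒even {m} f alternates =
  alternating-return⇒even (λ n → f (n mod suc m)) alternates-along-ℕ (suc m)
    (cong f (sym (n-mod-n≡zero m)))
  where
  alternates-along-ℕ : ∀ n → f (n mod suc m) ≢ f (suc n mod suc m)
  alternates-along-ℕ n = subst (λ k → f (n mod suc m) ≢ f k) (csuc-mod m n) (alternates (n mod suc m))

parity : Fin 6 → Bool
parity zero = true
parity (suc zero) = false
parity (suc (suc zero)) = true
parity (suc (suc (suc zero))) = false
parity (suc (suc (suc (suc zero)))) = true
parity (suc (suc (suc (suc (suc zero))))) = false

axis : Fin 6 → Fin 3
axis zero = zero
axis (suc zero) = suc zero
axis (suc (suc zero)) = suc (suc zero)
axis (suc (suc (suc zero))) = zero
axis (suc (suc (suc (suc zero)))) = suc zero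
axis (suc (suc (suc (suc (suc zero))))) = suc (suc zero)

opposite : Fin 6 → Fin 6
opposite = next6 ∘ next6 ∘ next6

next6-injective : ∀ i j → next6 i ≡ next6 j → i ≡ j
next6-injective = from-yes (all? λ i → all? λ j → next6 i ≟ᶠ next6 j →-dec i ≟ᶠ j)

opposite-next6 : ∀ j → opposite (next6 j) ≡ next6 (opposite j)
opposite-next6 = from-yes (all? λ j → opposite (next6 j) ≟ᶠ next6 (opposite j))

parity-next6 : ∀ j → parity j ≢ parity (next6 j)
parity-next6 = from-yes (all? λ j → ¬? (parity j ≟ᵇ parity (next6 j)))

parity-opposite : ∀ j → parity j ≢ parity (opposite j)
parity-opposite = from-yes (all? λ j → ¬? (parity j ≟ᵇ parity (opposite j)))

axis-fibre : ∀ a b → axis a ≡ axis b → a ≡ b ⊎ b ≡ opposite a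
axis-fibre = from-yes (all? λ a → all? λ b →
  axis a ≟ᶠ axis b →-dec (a ≟ᶠ b ⊎-dec b ≟ᶠ opposite a))

dir≢origin : ∀ j → dir j ≢ (+ 0 , + 0)
dir≢origin = from-yes (all? λ j → ¬? (≡-dec _≟ᶻ_ _≟ᶻ_ (dir j) (+ 0 , + 0)))

⊕-cancelʳ : ∀ {u w} d → u ⊕ d ≡ w ⊕ d → u ≡ w
⊕-cancelʳ {a , b} {c , e} (x , y) eq =
  cong₂ _,_ (∙-cancelʳ x a c (cong proj₁ eq)) (∙-cancelʳ y b e (cong proj₂ eq))

⊕-identityʳ-unique : ∀ v d → v ⊕ d ≡ v → d ≡ (+ 0 , + 0)
⊕-identityʳ-unique (a , b) (x , y) eq =
  cong₂ _,_ (identityʳ-unique a x (cong proj₁ eq)) (identityʳ-unique b y (cong proj₂ eq))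

⊕-dir-no-fixpoint : ∀ v j → v ⊕ dir j ≢ v
⊕-dir-no-fixpoint v j = dir≢origin j ∘ ⊕-identityʳ-unique v (dir j)

mid-axis : ∀ v j → proj₂ (mid v j) ≡ axis j
mid-axis v zero = refl
mid-axis v (suc zero) = refl
mid-axis v (suc (suc zero)) = refl
mid-axis v (suc (suc (suc zero))) = refl
mid-axis v (suc (suc (suc (suc zero)))) = refl
mid-axis v (suc (suc (suc (suc (suc zero))))) = refl

mid-injectiveˡ : ∀ {v w} j → mid v j ≡ mid w j → v ≡ w
mid-injectiveˡ zero = cong proj₁
mid-injectiveˡ (suc zero) = cong proj₁
mid-injectiveˡ (suc (suc zero)) = cong proj₁
mid-injectiveˡ j@(suc (suc (suc zero))) = ⊕-cancelʳ (dir j) ∘ cong proj₁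
mid-injectiveˡ j@(suc (suc (suc (suc zero)))) = ⊕-cancelʳ (dir j) ∘ cong proj₁
mid-injectiveˡ j@(suc (suc (suc (suc (suc zero))))) = ⊕-cancelʳ (dir j) ∘ cong proj₁

mid-opposite-distinct : ∀ v j → mid v j ≢ mid v (opposite j)
mid-opposite-distinct v j@zero = ⊕-dir-no-fixpoint v (opposite j) ∘ sym ∘ cong proj₁
mid-opposite-distinct v j@(suc zero) = ⊕-dir-no-fixpoint v (opposite j) ∘ sym ∘ cong proj₁
mid-opposite-distinct v j@(suc (suc zero)) = ⊕-dir-no-fixpoint v (opposite j) ∘ sym ∘ cong proj₁
mid-opposite-distinct v j@(suc (suc (suc zero))) = ⊕-dir-no-fixpoint v j ∘ cong proj₁
mid-opposite-distinct v j@(suc (suc (suc (suc zero)))) = ⊕-dir-no-fixpoint v j ∘ cong proj₁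
mid-opposite-distinct v j@(suc (suc (suc (suc (suc zero))))) = ⊕-dir-no-fixpoint v j ∘ cong proj₁

mid-meet : ∀ {v w} a b → mid v a ≡ mid w b → (v ≡ w × a ≡ b) ⊎ (v ≢ w × b ≡ opposite a)
mid-meet {v} {w} a b eq with axis-fibre a b (trans (sym (mid-axis v a)) (trans (cong proj₂ eq) (mid-axis w b)))
... | inj₁ refl = inj₁ (mid-injectiveˡ a eq , refl)
... | inj₂ refl = inj₂ ((λ { refl → mid-opposite-distinct v a eq }) , refl)

corner : Fin 6 → Role → Fin 6
corner j start = j
corner j end = next6 j

EndAt⇒≡mid : ∀ {v j p} ρ → EndAt (v , j) p ρ → p ≡ mid v (corner j ρ)
EndAt⇒≡mid start eq = eq
EndAt⇒≡mid end eq = eq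

same-circle-parity : ∀ {j j'} ρ ρ' → corner j ρ ≡ corner j' ρ' → j ≢ j' → parity j ≢ parity j'
same-circle-parity start start refl j≢j' = ⊥-elim (j≢j' refl)
same-circle-parity end end eq j≢j' = ⊥-elim (j≢j' (next6-injective _ _ eq))
same-circle-parity start end refl _ = ≢-sym (parity-next6 _)
same-circle-parity end start refl _ = parity-next6 _

tangent-circles-parity : ∀ {j j'} ρ → corner j' ρ ≡ opposite (corner j ρ) → parity j ≢ parity j'
tangent-circles-parity start refl = parity-opposite _
tangent-circles-parity {j} {j'} end eq =
  subst (λ k → parity j ≢ parity k) (sym j'≡opposite-j) (parity-opposite j)
  where
  j'≡opposite-j : j' ≡ opposite j
  j'≡opposite-j = next6-injective j' (opposite j) (trans eq (opposite-next6 j))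

smooth-junction-alternates : ∀ {p L L'} → SmoothAt p L L' → parity (proj₂ L) ≢ parity (proj₂ L')
smooth-junction-alternates {L = v , j} {w , j'} (ρ , ρ' , p≡ , p≡' , kind)
  with mid-meet (corner j ρ) (corner j' ρ') (trans (sym (EndAt⇒≡mid ρ p≡)) (EndAt⇒≡mid ρ' p≡')) | kind
... | inj₁ (_ , a≡b) | inj₁ (refl , L≢L') = same-circle-parity ρ ρ' a≡b λ { refl → L≢L' refl }
... | inj₁ (v≡w , _) | inj₂ (v≢w , _) = ⊥-elim (v≢w v≡w)
... | inj₂ (v≢w , _) | inj₁ (v≡w , _) = ⊥-elim (v≢w v≡w)
... | inj₂ (_ , b≡opposite-a) | inj₂ (_ , refl) = tangent-circles-parity ρ b≡opposite-a

corollary5p3 : (T : Tangle) → 2 ∣ length T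
corollary5p3 T = alternating-cycle⇒even (parity ∘ proj₂ ∘ links) (smooth-junction-alternates ∘ smooth)
  where open Tangle T
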